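{- Let $d,n \ge 1$ and let $s$ be an integer with $1 + \lceil d/n \rceil \le s \le d$. For any $v \in F_s$, the infection witness tree $\mathrm{IW}(v)$ has no directed path whose successive labels $u^1,\dots,u^m,u^{m+1}$ satisfy $u^{m+1} = u^1$ and $u^{i+1} \in \mathrm{Pre}(u^i)$ for all $1 \le i \le m$.
   Context: $[n] = \{1,\dots,n\}$, $[n]^d$ is the $d$-dimensional grid (vertices adjacent iff they differ by $1$ in exactly one coordinate), and $e_j$ is the $j$-th standard unit vector. For $d \le k \le dn$, $V_k = \{v \in [n]^d : \sum_{i=1}^d v_i = k\}$ (and $V_k=\emptyset$ otherwise). Set $F_s = \bigcup_{i=1}^{n-1} V_{(s-1)n+i}$. For $v \in F_s$ let $t_v = \sum_{i=1}^d v_i - (s-1)n$ and $\mathrm{Pre}(v) = \{v + e_j : v_j \le t_v\} \cup \{v - e_j : v_j > t_v\}$ (a set of $d$ vertices of $[n]^d$). The infection witness tree $\mathrm{IW}(v)$ is the directed rooted $d$-ary tree, edges directed away from the root, with vertices labelled by elements of $F_s \cup V_{(s-1)n} \cup V_{sn}$ (labels may repeat), built as follows: the root is labelled $v$ and declared active; repeatedly an active tree vertex is selected; if its label $u$ lies in $V_{(s-1)n} \cup V_{sn}$ it becomes a leaf and is made inactive; if $u \in F_s$ it is given $d$ active children labelled by the elements of $\mathrm{Pre}(u)$, and is made inactive. -}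

module Defs where

open import Data.Nat using (ℕ; zero; suc; _+_; _*_; _∸_; _≤_; _<_; pred)
open import Data.Nat.DivMod using (_/_)
open import Data.Fin using (Fin)
open import Data.Vec using (Vec; lookup; updateAt; sum)
open import Data.Vec.Relation.Unary.All using (All)
open import Data.Product using (Σ; _×_)
open import Data.Sum using (_⊎_)
open import Relation.Binary.PropositionalEquality using (_≡_)

-- ⌈ d / n ⌉ (value for n = 0 is irrelevant; only used with n ≥ 1)
ceilDiv : ℕ → ℕ → ℕ
ceilDiv d zero    = 0
ceilDiv d (suc k) = (d + k) / suc k

InGrid : (n : ℕ) {d : ℕ} → Vec ℕ d → Set
InGrid n v = All (λ x → 1 ≤ x × x ≤ n) v

InF : (n s : ℕ) {d : ℕ} → Vec ℕ d → Set
InF n s v = InGrid n v × ((s ∸ 1) * n + 1 ≤ sum v) × (sum v ≤ (s ∸ 1) * n + (n ∸ 1))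

tv : (n s : ℕ) {d : ℕ} → Vec ℕ d → ℕ
tv n s v = sum v ∸ (s ∸ 1) * n

InPre : (n s : ℕ) {d : ℕ} → Vec ℕ d → Vec ℕ d → Set
InPre n s {d} u w = Σ (Fin d) λ j →
    (lookup u j ≤ tv n s u × w ≡ updateAt u j suc)
  ⊎ (tv n s u < lookup u j × w ≡ updateAt u j pred)

-- An edge of IW(v): a tree vertex with label u ∈ F_s has a child with label w
-- for every w ∈ Pre(u) (vertices labelled in V_{(s-1)n} ∪ V_{sn} are leaves).
IWEdge : (n s : ℕ) {d : ℕ} → Vec ℕ d → Vec ℕ d → Set
IWEdge n s u w = InF n s u × InPre n s u w

-- Vertices of IW(v): a proof of  IWVertex n s v u  is a vertex of the tree
-- (the unique path from the root) carrying label u.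
data IWVertex (n s : ℕ) {d : ℕ} (v : Vec ℕ d) : Vec ℕ d → Set where
  root  : IWVertex n s v v
  child : ∀ {u w} → IWVertex n s v u → IWEdge n s u w → IWVertex n s v w

data IWPath (n s : ℕ) {d : ℕ} : ℕ → Vec ℕ d → Vec ℕ d → Set where
  here : ∀ {u} → IWPath n s 0 u u
  step : ∀ {m u w x} → IWEdge n s u w → IWPath n s m w x → IWPath n s (suc m) u x

-- Φ(u) = Σᵢ uᵢ² − t_u (t_u + 1) strictly decreases along every edge u → w of an
-- infection witness tree.  Raising a coordinate x ≤ t_u raises Σ uᵢ² by 2x + 1
-- and t by one, so t(t + 1) grows by 2t_u + 2 > 2x + 1; lowering a coordinate
-- x > t_u lowers Σ uᵢ² by 2x − 1 and t(t + 1) by 2t_u < 2x − 1.  A directed path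
-- returning to its starting label would therefore decrease Φ to below itself.
-- (t changes by exactly one because Σ uᵢ > (s − 1)n on F_s.)
module Submission where

open import Defs
open import Data.Nat using (ℕ; suc; _+_; _*_; _∸_; pred; _≤_; _<_; s≤s; z≤n)
open import Data.Nat.Properties
open import Algebra.Properties.CommutativeSemigroup +-commutativeSemigroup using (xy∙z≈zy∙x)
open import Data.Nat.Tactic.RingSolver using (solve)
open import Data.Fin using (Fin; zero; suc)
open import Data.List using (_∷_; [])
open import Data.Vec using (Vec; lookup; updateAt; sum; map)
open import Data.Product using (_,_)
open import Data.Sum using (inj₁; inj₂)
open import Function using (_∘_)
open import Relation.Nullary using (¬_)
open import Relation.Binary.PropositionalEquality

pronic : ℕ → ℕ
pronic t = t * suc t

-- Both inequalities below compare a′ − pronic t′ with a − pronic t, with the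
-- subtractions moved across so that everything stays in ℕ.
pronic-up : ∀ {a a′} x t → a′ + x * x ≡ a + suc x * suc x → x ≤ t →
  a′ + pronic t < a + pronic (suc t)
pronic-up {a} {a′} x t eq x≤t = +-cancelʳ-≤ (x * x) _ _ (begin
  suc (a′ + t * suc t) + x * x            ≡⟨ solve (a′ ∷ x ∷ t ∷ []) ⟩
  (a′ + x * x) + t * suc t + 1            ≡⟨ cong (λ z → z + t * suc t + 1) eq ⟩
  a + suc x * suc x + t * suc t + 1       ≡⟨ solve (a ∷ x ∷ t ∷ []) ⟩
  (a + x * x + t * suc t) + 2 * suc x     ≤⟨ +-monoʳ-≤ (a + x * x + t * suc t) (*-monoʳ-≤ 2 (s≤s x≤t)) ⟩
  (a + x * x + t * suc t) + 2 * suc t     ≡⟨ solve (a ∷ x ∷ t ∷ []) ⟩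
  a + suc t * suc (suc t) + x * x         ∎)
  where open ≤-Reasoning

pronic-down : ∀ {a a′} x t → a′ + x * x ≡ a + pred x * pred x → suc t < x →
  a′ + pronic (suc t) < a + pronic t
pronic-down {a} {a′} (suc y) t eq (s≤s t<y) = +-cancelʳ-≤ (suc y * suc y) _ _ (begin
  suc (a′ + suc t * suc (suc t)) + suc y * suc y  ≡⟨ solve (a′ ∷ y ∷ t ∷ []) ⟩
  (a′ + suc y * suc y) + suc t * suc (suc t) + 1  ≡⟨ cong (λ z → z + suc t * suc (suc t) + 1) eq ⟩
  a + y * y + suc t * suc (suc t) + 1             ≡⟨ solve (a ∷ y ∷ t ∷ []) ⟩
  (a + t * suc t + y * y) + (2 * suc t + 1)       ≤⟨ +-monoʳ-≤ (a + t * suc t + y * y) (+-monoˡ-≤ 1 (*-monoʳ-≤ 2 t<y)) ⟩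
  (a + t * suc t + y * y) + (2 * y + 1)           ≡⟨ solve (a ∷ y ∷ t ∷ []) ⟩
  a + t * suc t + suc y * suc y                   ∎)
  where open ≤-Reasoning

diff-<-≤-trans : ∀ {a b c d e f m} → c + b < a + d → e + d + m ≤ c + f → e + b + suc m ≤ a + f
diff-<-≤-trans {a} {b} {c} {d} {e} {f} {m} cb<ad edm≤cf = +-cancelʳ-≤ (c + d) _ _ (begin
  e + b + suc m + (c + d)    ≡⟨ solve (a ∷ b ∷ c ∷ d ∷ e ∷ f ∷ m ∷ []) ⟩
  suc (c + b) + (e + d + m)  ≤⟨ +-mono-≤ cb<ad edm≤cf ⟩
  a + d + (c + f)            ≡⟨ solve (a ∷ b ∷ c ∷ d ∷ e ∷ f ∷ m ∷ []) ⟩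
  a + f + (c + d)            ∎)
  where open ≤-Reasoning

module _ (n s : ℕ) {d : ℕ} (f g : Vec ℕ d → ℕ)
         (decreases : ∀ {u w} → IWEdge n s u w → f w + g u < f u + g w) where

  path-decreases : ∀ {m u x} → IWPath n s m u x → f x + g u + m ≤ f u + g x
  path-decreases here       = ≤-reflexive (+-identityʳ _)
  path-decreases {u = u} {x} (step {w = w} e p) =
    diff-<-≤-trans {f u} {g u} {f w} {g w} {f x} {g x} (decreases e) (path-decreases p)

  no-cycle : ∀ {m} {u : Vec ℕ d} → 1 ≤ m → ¬ IWPath n s m u u
  no-cycle {suc m} {u} _ p = m+1+n≰m (f u + g u) (path-decreases p)

-- Imported only after the uses of the ring solver: with the vector constructor
-- in scope its variable lists become ambiguous and checking them stalls.
open import Data.Vec using (_∷_)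

sumSq : ∀ {d} → Vec ℕ d → ℕ
sumSq xs = sum (map (λ x → x * x) xs)

sum-updateAt-suc : ∀ {d} (xs : Vec ℕ d) (i : Fin d) →
  sum (updateAt xs i suc) ≡ suc (sum xs)
sum-updateAt-suc (x ∷ xs) zero    = refl
sum-updateAt-suc (x ∷ xs) (suc i) =
  trans (cong (x +_) (sum-updateAt-suc xs i)) (+-suc x (sum xs))

sum-updateAt-pred : ∀ {d} (xs : Vec ℕ d) (i : Fin d) → 0 < lookup xs i →
  sum xs ≡ suc (sum (updateAt xs i pred))
sum-updateAt-pred (suc x ∷ xs) zero    _   = refl
sum-updateAt-pred (x ∷ xs)     (suc i) pos =
  trans (cong (x +_) (sum-updateAt-pred xs i pos)) (+-suc x _)

sum-map-updateAt : ∀ {d} (g f : ℕ → ℕ) (xs : Vec ℕ d) (i : Fin d) →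
  sum (map g (updateAt xs i f)) + g (lookup xs i) ≡ sum (map g xs) + g (f (lookup xs i))
sum-map-updateAt g f (x ∷ xs) zero = xy∙z≈zy∙x (g (f x)) (sum (map g xs)) (g x)
sum-map-updateAt g f (x ∷ xs) (suc i) = begin
  g x + sum (map g (updateAt xs i f)) + g (lookup xs i)    ≡⟨ +-assoc (g x) _ _ ⟩
  g x + (sum (map g (updateAt xs i f)) + g (lookup xs i))  ≡⟨ cong (g x +_) (sum-map-updateAt g f xs i) ⟩
  g x + (sum (map g xs) + g (f (lookup xs i)))             ≡⟨ +-assoc (g x) _ _ ⟨
  g x + sum (map g xs) + g (f (lookup xs i))               ∎
  where open ≡-Reasoning

tv-suc : ∀ n s {d} (u w : Vec ℕ d) → sum w ≡ suc (sum u) → (s ∸ 1) * n ≤ sum u →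
  tv n s w ≡ suc (tv n s u)
tv-suc n s u w w≡1+u b≤u = trans (cong (_∸ (s ∸ 1) * n) w≡1+u) (+-∸-assoc 1 b≤u)

edge-decreases : ∀ n s {d} {u w : Vec ℕ d} → IWEdge n s u w →
  sumSq w + pronic (tv n s u) < sumSq u + pronic (tv n s w)
edge-decreases n s {u = u} ((_ , b<u , _) , j , inj₁ (x≤t , refl)) =
  subst (λ t → sumSq w + pronic (tv n s u) < sumSq u + pronic t) (sym tw≡1+tu)
    (pronic-up (lookup u j) (tv n s u) (sum-map-updateAt (λ x → x * x) suc u j) x≤t)
  where
    w = updateAt u j suc
    tw≡1+tu : tv n s w ≡ suc (tv n s u)
    tw≡1+tu = tv-suc n s u w (sum-updateAt-suc u j) (m+n≤o⇒m≤o _ b<u)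
edge-decreases n s {u = u} ((_ , b<u , _) , j , inj₂ (t<x , refl)) =
  subst (λ t → sumSq w + pronic t < sumSq u + pronic (tv n s w)) (sym tu≡1+tw)
    (pronic-down (lookup u j) (tv n s w) (sum-map-updateAt (λ x → x * x) pred u j)
      (subst (_< lookup u j) tu≡1+tw t<x))
  where
    w = updateAt u j pred
    u≡1+w : sum u ≡ suc (sum w)
    u≡1+w = sum-updateAt-pred u j (≤-trans (s≤s z≤n) t<x)
    tu≡1+tw : tv n s u ≡ suc (tv n s w)
    tu≡1+tw = tv-suc n s w u u≡1+w (≤-pred (subst₂ _≤_ (+-comm _ 1) u≡1+w b<u))

-- Only the shape of the edges matters: no cycle exists anywhere in F_s.
lemma3 : (d n s : ℕ) → 1 ≤ d → 1 ≤ n → 1 + ceilDiv d n ≤ s → s ≤ d →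
    (v : Vec ℕ d) → InF n s v →
    (u : Vec ℕ d) → IWVertex n s v u →
    (m : ℕ) → 1 ≤ m → ¬ IWPath n s m u u
lemma3 d n s _ _ _ _ v _ u _ m 1≤m =
  no-cycle n s sumSq (pronic ∘ tv n s) (edge-decreases n s) 1≤m
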